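{- Let $G$ be a triangle-free graph in $W_2$. Assume $V(G)$ is partitioned as $V(G)=S\cup T\cup U$ (disjoint, possibly empty parts) such that $|S|+|T|\geqslant 2$ and every vertex in $U$ is adjacent to all vertices in $S\cup T$. Then $U=\emptyset$.
   Context: Graphs are finite, simple, without isolated vertices. $G$ is well-covered if all maximal independent sets have equal size; a well-covered $G$ is in $W_2$ if removing any vertex leaves a well-covered graph with the same independence number. -}

module Defs where

open import Data.Nat using (ℕ; _≤_)
open import Data.Fin using (Fin)
import Data.Fin as Fin
import Data.Nat as ℕ
open import Data.Fin.Subset using (Subset; _∈_; _∉_; ∣_∣; _⊆_)
open import Data.Bool using (Bool; true; false)
open import Data.Product using (Σ; ∃; _×_; _,_)
open import Relation.Binary.PropositionalEquality using (_≡_; _≢_)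
open import Relation.Nullary using (¬_)

record Graph (n : ℕ) : Set where
  field
    adj   : Fin n → Fin n → Bool
    sym   : ∀ u v → adj u v ≡ adj v u
    irrefl : ∀ v → adj v v ≡ false

open Graph public

Adj : ∀ {n} → Graph n → Fin n → Fin n → Set
Adj G u v = adj G u v ≡ true

-- No isolated vertices (standing assumption of the paper).
NoIsolated : ∀ {n} → Graph n → Set
NoIsolated {n} G = ∀ v → ∃ λ u → Adj G v u

TriangleFree : ∀ {n} → Graph n → Set
TriangleFree G = ∀ u v w → Adj G u v → Adj G v w → ¬ Adj G u w

Independent : ∀ {n} → Graph n → Subset n → Set
Independent G I = ∀ u v → u ∈ I → v ∈ I → ¬ Adj G u v

-- Maximal independent set of G - X  (X = set of removed vertices):
-- an independent set avoiding X which cannot be extended by any vertex outside X.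
MaximalIndepAvoiding : ∀ {n} → Graph n → (Fin n → Set) → Subset n → Set
MaximalIndepAvoiding {n} G removed I =
  Independent G I × (∀ v → v ∈ I → ¬ removed v) ×
  (∀ J → Independent G J → (∀ v → v ∈ J → ¬ removed v) → I ⊆ J → J ⊆ I)

MaximalIndependent : ∀ {n} → Graph n → Subset n → Set
MaximalIndependent G I = MaximalIndepAvoiding G (λ _ → Data.Empty.⊥) I
  where import Data.Empty

IndepNumberAvoiding : ∀ {n} → Graph n → (Fin n → Set) → ℕ → Set
IndepNumberAvoiding {n} G removed k =
  (∃ λ I → Independent G I × (∀ v → v ∈ I → ¬ removed v) × ∣ I ∣ ≡ k) ×
  (∀ I → Independent G I → (∀ v → v ∈ I → ¬ removed v) → ∣ I ∣ ≤ k)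

WellCoveredAvoiding : ∀ {n} → Graph n → (Fin n → Set) → Set
WellCoveredAvoiding G removed =
  ∀ I J → MaximalIndepAvoiding G removed I → MaximalIndepAvoiding G removed J → ∣ I ∣ ≡ ∣ J ∣

WellCovered : ∀ {n} → Graph n → Set
WellCovered G = WellCoveredAvoiding G (λ _ → Data.Empty.⊥)
  where import Data.Empty

IndepNumber : ∀ {n} → Graph n → ℕ → Set
IndepNumber G = IndepNumberAvoiding G (λ _ → Data.Empty.⊥)
  where import Data.Empty

InW2 : ∀ {n} → Graph n → Set
InW2 {n} G = WellCovered G ×
  (∀ (v : Fin n) → WellCoveredAvoiding G (λ u → u ≡ v) ×
     (∀ k → IndepNumber G k → IndepNumberAvoiding G (λ u → u ≡ v) k))

data Part : Set where
  S T U : Part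

isU : Part → Bool
isU U = true
isU S = false
isU T = false

countST : ∀ {n} → (Fin n → Part) → ℕ
countST {ℕ.zero} part = ℕ.zero
countST {ℕ.suc n} part with isU (part Fin.zero)
... | true  = countST (λ i → part (Fin.suc i))
... | false = ℕ.suc (countST (λ i → part (Fin.suc i)))

-- If v ∈ U, then U and S ∪ T are both independent (in a triangle-free graph each has a
-- common neighbour on the other side) and each dominates the other, so both are maximal
-- independent sets of G. Deleting a vertex w ∈ S ∪ T keeps U maximal in G − w, while
-- (S ∪ T) − w is still maximal there because |S ∪ T| ≥ 2 leaves it a vertex adjacent to
-- all of U. Well-coveredness of G and of G − w then gives |U| = |S ∪ T| = |S ∪ T| − 1.
module Submission where

open import Defs
open import Data.Nat using (ℕ; zero; suc; _≤_)
open import Data.Nat.Properties using (≤-trans; ≤-reflexive; <⇒≱; <-irrefl)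
open import Data.Fin using (Fin)
import Data.Fin as Fin
open import Data.Fin.Properties using (_≟_)
open import Data.Fin.Subset using (Subset; _∈_; _∉_; _⊆_; ∣_∣; ∁; _-_; ⁅_⁆; Nonempty)
open import Data.Fin.Subset.Properties
  using (_∈?_; nonempty?; x∈⁅x⁆; ∣⁅x⁆∣≡1; p⊆q⇒∣p∣≤∣q∣; x∈p∧x≢y⇒x∈p-y; p─q⊆p;
         x∈p⇒∣p-x∣<∣p∣; x∈∁p⇒x∉p; x∉∁p⇒x∈p; ⊆-refl)
open import Data.Vec using (tabulate; _∷_; there)
open import Data.Vec.Properties using (lookup∘tabulate; lookup⇒[]=; []=⇒lookup)
open import Data.Bool using (true; false)
open import Data.Product using (∃; _×_; _,_; proj₁)
open import Data.Empty using (⊥-elim)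
open import Relation.Nullary using (¬_; yes; no)
open import Relation.Binary.PropositionalEquality using (_≡_; _≢_; refl; trans; cong; subst)
import Relation.Binary.PropositionalEquality as ≡

x∉p-x : ∀ {n} (p : Subset n) (x : Fin n) → x ∉ p - x
x∉p-x (_ ∷ p) Fin.zero    ()
x∉p-x (_ ∷ p) (Fin.suc x) (there x∈p-x) = x∉p-x p x x∈p-x

2≤∣p∣⇒Nonempty[p-x] : ∀ {n} {p : Subset n} (x : Fin n) → 2 ≤ ∣ p ∣ → Nonempty (p - x)
2≤∣p∣⇒Nonempty[p-x] {p = p} x 2≤∣p∣ with nonempty? (p - x)
... | yes nonempty = nonempty
... | no empty = ⊥-elim (<⇒≱ 2≤∣p∣ (≤-trans (p⊆q⇒∣p∣≤∣q∣ p⊆⁅x⁆) (≤-reflexive (∣⁅x⁆∣≡1 x))))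
  where
  p⊆⁅x⁆ : p ⊆ ⁅ x ⁆
  p⊆⁅x⁆ {y} y∈p with y ≟ x
  ... | yes refl = x∈⁅x⁆ x
  ... | no y≢x = ⊥-elim (empty (y , x∈p∧x≢y⇒x∈p-y y∈p y≢x))

partU : ∀ {n} → (Fin n → Part) → Subset n
partU part = tabulate (λ i → isU (part i))

isU≡true⇒≡U : ∀ p → isU p ≡ true → p ≡ U
isU≡true⇒≡U U _ = refl

∈partU⇒≡U : ∀ {n} (part : Fin n → Part) {x} → x ∈ partU part → part x ≡ U
∈partU⇒≡U part {x} x∈U =
  isU≡true⇒≡U (part x) (trans (≡.sym (lookup∘tabulate _ x)) ([]=⇒lookup x∈U))

≡U⇒∈partU : ∀ {n} (part : Fin n → Part) {x} → part x ≡ U → x ∈ partU part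
≡U⇒∈partU part {x} px≡U = lookup⇒[]= x _ (trans (lookup∘tabulate _ x) (cong isU px≡U))

countST≡∣∁partU∣ : ∀ {n} (part : Fin n → Part) → countST part ≡ ∣ ∁ (partU part) ∣
countST≡∣∁partU∣ {zero} part = refl
countST≡∣∁partU∣ {suc n} part with isU (part Fin.zero)
... | true = countST≡∣∁partU∣ (λ i → part (Fin.suc i))
... | false = cong suc (countST≡∣∁partU∣ (λ i → part (Fin.suc i)))

module _ {n : ℕ} (G : Graph n) where

  Adj-sym : ∀ {u v} → Adj G u v → Adj G v u
  Adj-sym {u} {v} u~v = trans (Graph.sym G v u) u~v

  Dominating : (Fin n → Set) → Subset n → Set
  Dominating removed I = ∀ x → x ∉ I → ¬ removed x → ∃ λ y → y ∈ I × Adj G x y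

  independent∧dominating⇒maximal : ∀ {removed I} →
    Independent G I → (∀ v → v ∈ I → ¬ removed v) → Dominating removed I →
    MaximalIndepAvoiding G removed I
  independent∧dominating⇒maximal {removed} {I} indI avoidI dom = indI , avoidI , extend
    where
    extend : ∀ J → Independent G J → (∀ v → v ∈ J → ¬ removed v) → I ⊆ J → J ⊆ I
    extend J indJ avoidJ I⊆J {x} x∈J with x ∈? I
    ... | yes x∈I = x∈I
    ... | no x∉I with dom x x∉I (avoidJ x x∈J)
    ...   | y , y∈I , x~y = ⊥-elim (indJ x y x∈J (I⊆J y∈I) x~y)

  commonNeighbour⇒independent : TriangleFree G → ∀ {c I} →
    (∀ x → x ∈ I → Adj G c x) → Independent G I
  commonNeighbour⇒independent tf {c} c~I a b a∈I b∈I a~b =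
    tf c a b (c~I a a∈I) a~b (c~I b b∈I)

  CompleteToComplement : Subset n → Set
  CompleteToComplement A = ∀ u w → u ∈ A → w ∉ A → Adj G u w

  module _ (tf : TriangleFree G) {A : Subset n} (A~∁A : CompleteToComplement A) where

    A~∁A′ : ∀ {u w} → u ∈ A → w ∈ ∁ A → Adj G u w
    A~∁A′ {u} {w} u∈A w∈∁A = A~∁A u w u∈A (x∈∁p⇒x∉p w∈∁A)

    ⊆∁A⇒independent : ∀ {a I} → a ∈ A → I ⊆ ∁ A → Independent G I
    ⊆∁A⇒independent a∈A I⊆∁A =
      commonNeighbour⇒independent tf (λ x x∈I → A~∁A′ a∈A (I⊆∁A x∈I))

    A-maximal : ∀ {removed a w} → a ∈ A → w ∈ ∁ A → (∀ v → v ∈ A → ¬ removed v) →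
      MaximalIndepAvoiding G removed A
    A-maximal {a = a} a∈A w∈∁A avoidA = independent∧dominating⇒maximal
      (commonNeighbour⇒independent tf (λ x x∈A → Adj-sym (A~∁A′ x∈A w∈∁A)))
      avoidA
      (λ x x∉A _ → a , a∈A , Adj-sym (A~∁A a x a∈A x∉A))

    ∁A-maximal : ∀ {a w} → a ∈ A → w ∈ ∁ A → MaximalIndependent G (∁ A)
    ∁A-maximal {w = w} a∈A w∈∁A = independent∧dominating⇒maximal
      (⊆∁A⇒independent a∈A ⊆-refl)
      (λ _ _ ())
      (λ x x∉∁A _ → w , w∈∁A , A~∁A′ (x∉∁p⇒x∈p x∉∁A) w∈∁A)

    ∁A-w-maximal : ∀ {a w w′} → a ∈ A → w′ ∈ ∁ A - w →
      MaximalIndepAvoiding G (_≡ w) (∁ A - w)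
    ∁A-w-maximal {w = w} {w′} a∈A w′∈∁A-w = independent∧dominating⇒maximal
      (⊆∁A⇒independent a∈A (p─q⊆p _ _))
      (λ x x∈∁A-w x≡w → x∉p-x (∁ A) w (subst (_∈ ∁ A - w) x≡w x∈∁A-w))
      (λ x x∉∁A-w x≢w → w′ , w′∈∁A-w ,
         A~∁A′ (x∉∁p⇒x∈p (λ x∈∁A → x∉∁A-w (x∈p∧x≢y⇒x∈p-y x∈∁A x≢w))) (p─q⊆p _ _ w′∈∁A-w))

  triangleFree∧W₂⇒¬completeToComplement : TriangleFree G → WellCovered G →
    (∀ w → WellCoveredAvoiding G (_≡ w)) →
    ∀ {A} → Nonempty A → 2 ≤ ∣ ∁ A ∣ → ¬ CompleteToComplement A
  triangleFree∧W₂⇒¬completeToComplement tf wc wc-del {A} (a , a∈A) 2≤∣∁A∣ A~∁A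
    with 2≤∣p∣⇒Nonempty[p-x] {p = ∁ A} a 2≤∣∁A∣
  ... | w , w∈∁A-a with 2≤∣p∣⇒Nonempty[p-x] {p = ∁ A} w 2≤∣∁A∣
  ... | w′ , w′∈∁A-w = <-irrefl (trans (≡.sym ∣A∣≡∣∁A-w∣) ∣A∣≡∣∁A∣) (x∈p⇒∣p-x∣<∣p∣ w∈∁A)
    where
    w∈∁A : w ∈ ∁ A
    w∈∁A = p─q⊆p _ _ w∈∁A-a
    ∣A∣≡∣∁A∣ : ∣ A ∣ ≡ ∣ ∁ A ∣
    ∣A∣≡∣∁A∣ = wc A (∁ A) (A-maximal tf A~∁A a∈A w∈∁A (λ _ _ ())) (∁A-maximal tf A~∁A a∈A w∈∁A)
    ∣A∣≡∣∁A-w∣ : ∣ A ∣ ≡ ∣ ∁ A - w ∣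
    ∣A∣≡∣∁A-w∣ = wc-del w A (∁ A - w)
      (A-maximal tf A~∁A a∈A w∈∁A (λ v v∈A v≡w → x∈∁p⇒x∉p w∈∁A (subst (_∈ A) v≡w v∈A)))
      (∁A-w-maximal tf A~∁A a∈A w′∈∁A-w)

lemma2p2 : ∀ {n} (G : Graph n) → NoIsolated G → TriangleFree G → InW2 G →
    (part : Fin n → Part) → 2 ≤ countST part →
    (∀ u w → part u ≡ U → part w ≢ U → Adj G u w) →
    ∀ v → part v ≢ U
lemma2p2 G _ tf (wc , wc-del) part 2≤countST U~ST v pv≡U =
  triangleFree∧W₂⇒¬completeToComplement G tf wc (λ w → proj₁ (wc-del w))
    (v , ≡U⇒∈partU part pv≡U)
    (subst (2 ≤_) (countST≡∣∁partU∣ part) 2≤countST)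
    (λ u w u∈U w∉U → U~ST u w (∈partU⇒≡U part u∈U) (λ pw≡U → w∉U (≡U⇒∈partU part pw≡U)))
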